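{- For every integer $n \geq 4$, the diameter of the cubical staircase graph $CS_n$ is $\operatorname{diam}(CS_n) = 3(n-3)$.
   Context: For a natural number $n \geq 3$, the cubical staircase graph $CS_n$ is the graph with vertex set $\{(i,j,k) : 1 \leq i \leq n-2,\ 1 \leq j \leq i,\ 1 \leq k \leq n-1-i\}$ and edge set consisting of the pairs $(i,j,k)(i,j,k+1)$ for $1\le i\le n-2$, $1\le j\le i$, $1\le k\le n-2-i$; the pairs $(i,j,k)(i+1,j,k)$ for $1\le i\le n-3$, $1\le j\le i$, $1\le k\le n-1-i$; and the pairs $(i,j,k)(i,j+1,k)$ for $1\le i\le n-2$, $1\le j\le i-1$, $1\le k\le n-1-i$ (only pairs of vertices of $CS_n$ are included). The diameter is $\operatorname{diam}(G)=\max\{d_G(u,v): u,v\in V(G)\}$, where $d_G$ is the shortest-path distance. -}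

module Defs where

open import Data.Nat using (ℕ; zero; suc; _+_; _*_; _∸_; _≤_; _<_)
open import Data.Product using (Σ; _×_; _,_; ∃)
open import Data.Sum using (_⊎_)
open import Relation.Binary.PropositionalEquality using (_≡_)

Triple : Set
Triple = ℕ × ℕ × ℕ

IsVertex : ℕ → Triple → Set
IsVertex n (i , j , k) =
  (1 ≤ i × i ≤ n ∸ 2) × (1 ≤ j × j ≤ i) × (1 ≤ k × k ≤ (n ∸ 1) ∸ i)

-- The three kinds of generating pairs (as unordered edges we take
-- both orientations below); only pairs of vertices of CS_n are included.
data Step (n : ℕ) : Triple → Triple → Set where
  step-k : ∀ {i j k} → IsVertex n (i , j , k) → IsVertex n (i , j , suc k) →
           Step n (i , j , k) (i , j , suc k)
  step-i : ∀ {i j k} → IsVertex n (i , j , k) → IsVertex n (suc i , j , k) →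
           Step n (i , j , k) (suc i , j , k)
  step-j : ∀ {i j k} → IsVertex n (i , j , k) → IsVertex n (i , suc j , k) →
           Step n (i , j , k) (i , suc j , k)

Adj : ℕ → Triple → Triple → Set
Adj n u v = Step n u v ⊎ Step n v u

data Walk (n : ℕ) : Triple → Triple → ℕ → Set where
  [] : ∀ {u} → IsVertex n u → Walk n u u 0
  _∷_ : ∀ {u v w ℓ} → Adj n u v → Walk n v w ℓ → Walk n u w (suc ℓ)

Dist : ℕ → Triple → Triple → ℕ → Set
Dist n u v d = Walk n u v d × (∀ ℓ → Walk n u v ℓ → d ≤ ℓ)

IsDiameter : ℕ → ℕ → Set
IsDiameter n D =
  (∀ u v → IsVertex n u → IsVertex n v → Σ ℕ λ d → Dist n u v d × d ≤ D)
  × (Σ Triple λ u → Σ Triple λ v → IsVertex n u × IsVertex n v × Dist n u v D)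

{-# OPTIONS --safe #-}
module Submission where

-- Distances in CS_n are ℓ¹ distances of the coordinate triples. Every edge
-- changes one coordinate by one, so no walk is shorter than the ℓ¹ distance.
-- Conversely, for i ≤ i' one reaches (i' , j' , k') from (i , j , k) by a
-- monotone walk that stays in the vertex set: move i, then j, then k when
-- k ≤ k', and k, then i, then j otherwise. Every coordinate of a vertex of
-- CS_{m+3} lies in [1, m+1], so the ℓ¹ distance is at most 3m, with equality
-- for (1 , 1 , m+1) and (m+1 , m+1 , 1).

open import Defs
open import Data.Nat using (ℕ; zero; suc; _+_; _*_; _∸_; ∣_-_∣; _≤_; z≤n; s≤s)
open import Data.Nat.Properties
open import Algebra.Properties.CommutativeSemigroup +-commutativeSemigroup using (interchange)
open import Data.Product using (Σ; _×_; _,_)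
open import Data.Sum using (inj₁; inj₂)
open import Relation.Binary.PropositionalEquality

variable
  n : ℕ
  u v w : Triple

Step-source : Step n u v → IsVertex n u
Step-source (step-k p _) = p
Step-source (step-i p _) = p
Step-source (step-j p _) = p

Step-target : Step n u v → IsVertex n v
Step-target (step-k _ q) = q
Step-target (step-i _ q) = q
Step-target (step-j _ q) = q

Adj-sym : Adj n u v → Adj n v u
Adj-sym (inj₁ s) = inj₂ s
Adj-sym (inj₂ s) = inj₁ s

Adj-target : Adj n u v → IsVertex n v
Adj-target (inj₁ s) = Step-target s
Adj-target (inj₂ s) = Step-source s

infixr 5 _++_
infixl 5 _∷ʳ_

_∷ʳ_ : ∀ {l} → Walk n u v l → Adj n v w → Walk n u w (suc l)
[] _     ∷ʳ a = a ∷ [] (Adj-target a)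
(b ∷ ws) ∷ʳ a = b ∷ (ws ∷ʳ a)

reverse : ∀ {l} → Walk n u v l → Walk n v u l
reverse ([] p)   = [] p
reverse (a ∷ ws) = reverse ws ∷ʳ Adj-sym a

_++_ : ∀ {l l'} → Walk n u v l → Walk n v w l' → Walk n u w (l + l')
[] _     ++ ws' = ws'
(a ∷ ws) ++ ws' = a ∷ (ws ++ ws')

manhattan : Triple → Triple → ℕ
manhattan (i , j , k) (i' , j' , k') = ∣ i - i' ∣ + ∣ j - j' ∣ + ∣ k - k' ∣

manhattan-comm : ∀ u v → manhattan u v ≡ manhattan v u
manhattan-comm (i , j , k) (i' , j' , k')
  rewrite ∣-∣-comm i i' | ∣-∣-comm j j' | ∣-∣-comm k k' = refl

manhattan-self : ∀ u → manhattan u u ≡ 0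
manhattan-self (i , j , k) rewrite ∣n-n∣≡0 i | ∣n-n∣≡0 j | ∣n-n∣≡0 k = refl

manhattan-triangle : ∀ u v w → manhattan u w ≤ manhattan u v + manhattan v w
manhattan-triangle (i , j , k) (i' , j' , k') (i'' , j'' , k'') = begin
  ∣ i - i'' ∣ + ∣ j - j'' ∣ + ∣ k - k'' ∣
    ≤⟨ +-mono-≤ (+-mono-≤ (∣-∣-triangle i i' i'') (∣-∣-triangle j j' j''))
                (∣-∣-triangle k k' k'') ⟩
  (a + a') + (b + b') + (c + c')
    ≡⟨ cong (_+ (c + c')) (interchange a a' b b') ⟩
  (a + b) + (a' + b') + (c + c')
    ≡⟨ interchange (a + b) (a' + b') c c' ⟩
  (a + b + c) + (a' + b' + c') ∎
  where
    open ≤-Reasoning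
    a = ∣ i - i' ∣ ; b = ∣ j - j' ∣ ; c = ∣ k - k' ∣
    a' = ∣ i' - i'' ∣ ; b' = ∣ j' - j'' ∣ ; c' = ∣ k' - k'' ∣

∣n-1+n∣≡1 : ∀ x → ∣ x - suc x ∣ ≡ 1
∣n-1+n∣≡1 zero    = refl
∣n-1+n∣≡1 (suc x) = ∣n-1+n∣≡1 x

Step⇒manhattan≡1 : Step n u v → manhattan u v ≡ 1
Step⇒manhattan≡1 (step-k {i} {j} {k} _ _)
  rewrite ∣n-n∣≡0 i | ∣n-n∣≡0 j | ∣n-1+n∣≡1 k = refl
Step⇒manhattan≡1 (step-i {i} {j} {k} _ _)
  rewrite ∣n-1+n∣≡1 i | ∣n-n∣≡0 j | ∣n-n∣≡0 k = refl
Step⇒manhattan≡1 (step-j {i} {j} {k} _ _)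
  rewrite ∣n-n∣≡0 i | ∣n-1+n∣≡1 j | ∣n-n∣≡0 k = refl

Adj⇒manhattan≡1 : Adj n u v → manhattan u v ≡ 1
Adj⇒manhattan≡1 (inj₁ s) = Step⇒manhattan≡1 s
Adj⇒manhattan≡1 {u = u} {v} (inj₂ s) = trans (manhattan-comm u v) (Step⇒manhattan≡1 s)

manhattan≤length : ∀ {l} → Walk n u v l → manhattan u v ≤ l
manhattan≤length {u = u} ([] _) = ≤-reflexive (manhattan-self u)
manhattan≤length {u = u} {v} (_∷_ {v = w} {ℓ = l} a ws) = begin
  manhattan u v                 ≤⟨ manhattan-triangle u w v ⟩
  manhattan u w + manhattan w v ≡⟨ cong (_+ manhattan w v) (Adj⇒manhattan≡1 a) ⟩
  suc (manhattan w v)           ≤⟨ s≤s (manhattan≤length ws) ⟩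
  suc l                         ∎
  where open ≤-Reasoning

module Segment
  (f : ℕ → Triple)
  (step : ∀ {x} → IsVertex n (f x) → IsVertex n (f (suc x)) → Step n (f x) (f (suc x)))
  (convex : ∀ {a b c} → a ≤ b → b ≤ c → IsVertex n (f a) → IsVertex n (f c) → IsVertex n (f b))
  where

  ascending : ∀ d {x y} → d + x ≡ y → IsVertex n (f x) → IsVertex n (f y) → Walk n (f x) (f y) d
  ascending zero    refl vx _  = [] vx
  ascending (suc d) {x} refl vx vy = ascending d refl vx vz ∷ʳ inj₁ (step vz vy)
    where vz = convex (m≤n+m x d) (n≤1+n (d + x)) vx vy

  segment-≤ : ∀ {x y} → x ≤ y → IsVertex n (f x) → IsVertex n (f y) → Walk n (f x) (f y) ∣ x - y ∣
  segment-≤ {x} {y} x≤y vx vy =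
    subst (Walk n (f x) (f y)) (sym (m≤n⇒∣m-n∣≡n∸m x≤y))
      (ascending (y ∸ x) (m∸n+n≡m x≤y) vx vy)

  segment : ∀ x y → IsVertex n (f x) → IsVertex n (f y) → Walk n (f x) (f y) ∣ x - y ∣
  segment x y vx vy with ≤-total x y
  ... | inj₁ x≤y = segment-≤ x≤y vx vy
  ... | inj₂ y≤x = subst (Walk n (f x) (f y)) (∣-∣-comm y x) (reverse (segment-≤ y≤x vy vx))

segment-i : ∀ {i i' j k} → IsVertex n (i , j , k) → IsVertex n (i' , j , k) →
            Walk n (i , j , k) (i' , j , k) ∣ i - i' ∣
segment-i {n} {i} {i'} {j} {k} = Segment.segment (λ x → x , j , k) step-i convex i i'
  where
    convex : ∀ {a b c} → a ≤ b → b ≤ c →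
             IsVertex n (a , j , k) → IsVertex n (c , j , k) → IsVertex n (b , j , k)
    convex a≤b b≤c ((1≤a , _) , (1≤j , j≤a) , (1≤k , _)) ((_ , c≤n-2) , _ , (_ , k≤n-1-c)) =
      (≤-trans 1≤a a≤b , ≤-trans b≤c c≤n-2) , (1≤j , ≤-trans j≤a a≤b) ,
      (1≤k , ≤-trans k≤n-1-c (∸-monoʳ-≤ (n ∸ 1) b≤c))

segment-j : ∀ {i j j' k} → IsVertex n (i , j , k) → IsVertex n (i , j' , k) →
            Walk n (i , j , k) (i , j' , k) ∣ j - j' ∣
segment-j {n} {i} {j} {j'} {k} = Segment.segment (λ x → i , x , k) step-j convex j j'
  where
    convex : ∀ {a b c} → a ≤ b → b ≤ c →
             IsVertex n (i , a , k) → IsVertex n (i , c , k) → IsVertex n (i , b , k)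
    convex a≤b b≤c (vi , (1≤a , _) , vk) (_ , (_ , c≤i) , _) =
      vi , (≤-trans 1≤a a≤b , ≤-trans b≤c c≤i) , vk

segment-k : ∀ {i j k k'} → IsVertex n (i , j , k) → IsVertex n (i , j , k') →
            Walk n (i , j , k) (i , j , k') ∣ k - k' ∣
segment-k {n} {i} {j} {k} {k'} = Segment.segment (λ x → i , j , x) step-k convex k k'
  where
    convex : ∀ {a b c} → a ≤ b → b ≤ c →
             IsVertex n (i , j , a) → IsVertex n (i , j , c) → IsVertex n (i , j , b)
    convex a≤b b≤c (vi , vj , (1≤a , _)) (_ , _ , (_ , c≤n-1-i)) =
      vi , vj , (≤-trans 1≤a a≤b , ≤-trans b≤c c≤n-1-i)

walk-of-manhattan-length-≤ : ∀ {i j k i' j' k'} → i ≤ i' →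
  IsVertex n (i , j , k) → IsVertex n (i' , j' , k') →
  Walk n (i , j , k) (i' , j' , k') (manhattan (i , j , k) (i' , j' , k'))
walk-of-manhattan-length-≤ {n} {i} {j} {k} {i'} {j'} {k'} i≤i'
  vu@(vi , (1≤j , j≤i) , (1≤k , k≤n-1-i)) vv@(vi' , (1≤j' , j'≤i') , (1≤k' , k'≤n-1-i'))
  with ≤-total k k'
... | inj₁ k≤k' = (segment-i vu v₁ ++ segment-j v₁ v₂) ++ segment-k v₂ vv
  where
    v₁ : IsVertex n (i' , j , k)
    v₁ = vi' , (1≤j , ≤-trans j≤i i≤i') , (1≤k , ≤-trans k≤k' k'≤n-1-i')
    v₂ : IsVertex n (i' , j' , k)
    v₂ = vi' , (1≤j' , j'≤i') , (1≤k , ≤-trans k≤k' k'≤n-1-i')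
... | inj₂ k'≤k = subst (Walk n (i , j , k) (i' , j' , k')) (+-comm ∣ k - k' ∣ _)
                    (segment-k vu v₁ ++ segment-i v₁ v₂ ++ segment-j v₂ vv)
  where
    v₁ : IsVertex n (i , j , k')
    v₁ = vi , (1≤j , j≤i) , (1≤k' , ≤-trans k'≤k k≤n-1-i)
    v₂ : IsVertex n (i' , j , k')
    v₂ = vi' , (1≤j , ≤-trans j≤i i≤i') , (1≤k' , k'≤n-1-i')

walk-of-manhattan-length : IsVertex n u → IsVertex n v → Walk n u v (manhattan u v)
walk-of-manhattan-length {n} {u@(i , _ , _)} {v@(i' , _ , _)} vu vv with ≤-total i i'
... | inj₁ i≤i' = walk-of-manhattan-length-≤ i≤i' vu vv
... | inj₂ i'≤i = subst (Walk n u v) (manhattan-comm v u)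
                    (reverse (walk-of-manhattan-length-≤ i'≤i vv vu))

Dist-manhattan : IsVertex n u → IsVertex n v → Dist n u v (manhattan u v)
Dist-manhattan vu vv = walk-of-manhattan-length vu vv , λ _ → manhattan≤length

InBox : ℕ → Triple → Set
InBox m (i , j , k) = (1 ≤ i × i ≤ suc m) × (1 ≤ j × j ≤ suc m) × (1 ≤ k × k ≤ suc m)

IsVertex⇒InBox : ∀ {m} → IsVertex (3 + m) u → InBox m u
IsVertex⇒InBox {u = suc i , j , k} {m} ((1≤i , i≤m+1) , (1≤j , j≤i) , (1≤k , k≤m+1-i)) =
  (1≤i , i≤m+1) , (1≤j , ≤-trans j≤i i≤m+1) , (1≤k , ≤-trans k≤m+1-i (m∸n≤m (suc m) i))

∣m-n∣≤o-on-[1,1+o] : ∀ {m n o} → 1 ≤ m → m ≤ suc o → 1 ≤ n → n ≤ suc o → ∣ m - n ∣ ≤ o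
∣m-n∣≤o-on-[1,1+o] {suc m} {suc n} _ (s≤s m≤o) _ (s≤s n≤o) =
  ≤-trans (∣m-n∣≤m⊔n m n) (⊔-lub m≤o n≤o)

m+m+m≡3*m : ∀ m → m + m + m ≡ 3 * m
m+m+m≡3*m m = trans (+-assoc m m m) (cong (λ t → m + (m + t)) (sym (+-identityʳ m)))

manhattan≤3*m : ∀ {m} → InBox m u → InBox m v → manhattan u v ≤ 3 * m
manhattan≤3*m {u = i , j , k} {i' , j' , k'} {m} ((1≤i , i≤) , (1≤j , j≤) , (1≤k , k≤))
                                             ((1≤i' , i'≤) , (1≤j' , j'≤) , (1≤k' , k'≤)) = begin
  ∣ i - i' ∣ + ∣ j - j' ∣ + ∣ k - k' ∣
    ≤⟨ +-mono-≤ (+-mono-≤ (∣m-n∣≤o-on-[1,1+o] 1≤i i≤ 1≤i' i'≤)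
                          (∣m-n∣≤o-on-[1,1+o] 1≤j j≤ 1≤j' j'≤))
                (∣m-n∣≤o-on-[1,1+o] 1≤k k≤ 1≤k' k'≤) ⟩
  m + m + m ≡⟨ m+m+m≡3*m m ⟩
  3 * m ∎
  where open ≤-Reasoning

CS-diameter : ∀ m → IsDiameter (3 + m) (3 * m)
CS-diameter m = every-pair-within-3m , (1 , 1 , suc m) , (suc m , suc m , 1) , vu , vv , Dist-corners
  where
    every-pair-within-3m : ∀ u v → IsVertex (3 + m) u → IsVertex (3 + m) v →
                           Σ ℕ λ d → Dist (3 + m) u v d × d ≤ 3 * m
    every-pair-within-3m u v vu vv =
      manhattan u v , Dist-manhattan vu vv , manhattan≤3*m (IsVertex⇒InBox vu) (IsVertex⇒InBox vv)
    vu : IsVertex (3 + m) (1 , 1 , suc m)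
    vu = (≤-refl , s≤s z≤n) , (≤-refl , ≤-refl) , (s≤s z≤n , ≤-refl)
    vv : IsVertex (3 + m) (suc m , suc m , 1)
    vv = (s≤s z≤n , ≤-refl) , (s≤s z≤n , ≤-refl) , (≤-refl , ≤-reflexive (sym (m+n∸n≡m 1 m)))
    Dist-corners : Dist (3 + m) (1 , 1 , suc m) (suc m , suc m , 1) (3 * m)
    Dist-corners = subst (Dist (3 + m) _ _)
                     (trans (cong (m + m +_) (∣-∣-identityʳ m)) (m+m+m≡3*m m))
                     (Dist-manhattan vu vv)

theorem5 : (n : ℕ) → 4 ≤ n → IsDiameter n (3 * (n ∸ 3))
theorem5 1 (s≤s ())
theorem5 2 (s≤s (s≤s ()))
theorem5 (suc (suc (suc m))) _ = CS-diameter m
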